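{- Let $\mathcal{T}(X_0)$ be a discrete generation pedigree of order $n > 3$, with $X_0 = \{x_1,\dots,x_n\}$, and let $G_1$ be the edge-labelled multigraph with vertex set $X_1$ in which, for each $i$, the two parents of $x_i$ are joined by an edge $e_i$. If $G_1$ contains a cycle, then $\mathcal{T}(X_0)$ is uniquely determined by $S_{n-1}(\mathcal{T})$: every pedigree $\mathcal{U}(X_0)$ that is $(n-1)$-hypomorphic to $\mathcal{T}(X_0)$ is isomorphic to $\mathcal{T}(X_0)$ via an isomorphism fixing every vertex of $X_0$.
   Context: A pedigree $\mathcal{T}(X_0)$ on a set $X_0$ is a finite directed graph (no loops, no multiple arcs) on a vertex set $V$ such that every vertex has out-degree $0$ or $2$, $X_0 \subseteq V$ consists of vertices of in-degree $0$ (called extant), and there are no isolated vertices; $|X_0|$ is its order. If $uv$ is an arc, $v$ is a parent of $u$. A discrete generation pedigree is one whose vertex set is a disjoint union $X_0 \cup X_1 \cup \dots \cup X_d$, where $X_d$ is the set of vertices of out-degree $0$ and each vertex of $X_i$, $i<d$, has its two parents in $X_{i+1}$. A vertex $v$ is a descendant of $u$ if there is a directed path from $v$ to $u$ (including $v=u$). For $Y \subseteq X_0$, the sub-pedigree $\mathcal{T}(Y)$ is obtained by deleting every vertex with no descendant in $Y$. Isomorphisms of pedigrees are arc-preserving bijections (in both directions) fixing each labelled extant vertex; other vertices are unlabelled. $S_{n-1}(\mathcal{T}) = \{\mathcal{T}(Y) : Y \subset X_0, |Y| = n-1\}$, each given up to such isomorphism. Two pedigrees $\mathcal{T}(X_0),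 \mathcal{U}(X_0)$ of order $n$ are $(n-1)$-hypomorphic if for every $Y \subset X_0$ with $|Y|=n-1$ there is an isomorphism $\mathcal{T}(Y) \to \mathcal{U}(Y)$ fixing each vertex of $Y$. -}

module Defs where

open import Data.Nat using (ℕ; zero; suc; _≤_; _<_)
open import Data.Fin using (Fin; inject₁; fromℕ) renaming (zero to fzero; suc to fsuc)
open import Data.Fin.Subset using (Subset; _∈_; ∣_∣)
open import Data.Maybe using (Maybe; just; nothing)
open import Data.Product using (Σ; ∃; ∃-syntax; _×_; _,_)
open import Data.Sum using (_⊎_)
open import Data.Irrelevant using ([_])
open import Data.Refinement using (Refinement; value; _,_)
open import Function.Definitions using (Injective)
open import Function.Bundles using (_↔_; _⇔_; Inverse)
open import Relation.Binary.PropositionalEquality using (_≡_; _≢_; refl)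
open import Relation.Nullary using (¬_)

-- Raw pedigree data on the labelled extant set X₀ = {x₁,…,xₙ} ≅ Fin n.  A vertex either has no parents (out-degree 0)
-- or exactly two parents (out-degree 2); the arcs are u → p for each
-- parent p of u.

record RawPedigree (n : ℕ) : Set where
  field
    size    : ℕ
    parents : Fin size → Maybe (Fin size × Fin size)
    extant  : Fin n → Fin size

  V : Set
  V = Fin size

  Arc : V → V → Set
  Arc u v = ∃[ a ] ∃[ b ] (parents u ≡ just (a , b) × (v ≡ a ⊎ v ≡ b))

  -- v is a descendant of u : there is a directed path from v to u
  data Desc : V → V → Set where
    here  : ∀ {v} → Desc v v
    there : ∀ {v w u} → Arc v w → Desc w u → Desc v u

open RawPedigree public

record IsPedigree {n : ℕ} (T : RawPedigree n) : Set where
  field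
    parents-ok  : ∀ u a b → parents T u ≡ just (a , b) → a ≢ b × a ≢ u × b ≢ u
    extant-inj  : Injective _≡_ _≡_ (extant T)
    extant-in0  : ∀ u i → ¬ Arc T u (extant T i)
    no-isolated : ∀ v → (∃[ w ] Arc T v w) ⊎ (∃[ u ] Arc T u v)
    -- 𝒯 = 𝒯(X₀): every vertex has a descendant in X₀
    ancestral   : ∀ v → ∃[ i ] Desc T (extant T i) v

record Pedigree (n : ℕ) : Set where
  field
    raw : RawPedigree n
    ok  : IsPedigree raw

open Pedigree public

-- Discrete generation: V = X₀ ⊔ X₁ ⊔ … ⊔ X_d, encoded by the generation
-- index gen v = i iff v ∈ Xᵢ.
record DiscreteGeneration {n : ℕ} (T : Pedigree n) : Set where
  field
    d    : ℕ
    gen  : V (raw T) → ℕ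
    gen≤ : ∀ v → gen v ≤ d
    gen0 : ∀ v → gen v ≡ 0 ⇔ (∃[ i ] extant (raw T) i ≡ v)
    genD : ∀ v → gen v ≡ d ⇔ parents (raw T) v ≡ nothing
    genP : ∀ v a b → gen v < d → parents (raw T) v ≡ just (a , b) →
           gen a ≡ suc (gen v) × gen b ≡ suc (gen v)

-- The edge-labelled multigraph G₁ on X₁: edge eᵢ joins the two parents
-- of xᵢ.

Joins : ∀ {n} (T : Pedigree n) → Fin n → V (raw T) → V (raw T) → Set
Joins T i u w =
  parents (raw T) (extant (raw T) i) ≡ just (u , w) ⊎
  parents (raw T) (extant (raw T) i) ≡ just (w , u)

-- G₁ contains a cycle: k ≥ 2 distinct edges e_{j}, distinct vertices
-- v₀,…,v_{k-1}, with edge j joining v_j and v_{j+1} (indices mod k,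
-- i.e. vs (fromℕ k) = vs 0).
G₁HasCycle : ∀ {n} (T : Pedigree n) → Set
G₁HasCycle {n} T =
  ∃[ k ] (2 ≤ k ×
    Σ (Fin k → Fin n) λ es →
    Σ (Fin (suc k) → V (raw T)) λ vs →
      Injective _≡_ _≡_ es ×
      Injective _≡_ _≡_ (λ j → vs (inject₁ j)) ×
      vs (fromℕ k) ≡ vs fzero ×
      (∀ j → Joins T (es j) (vs (inject₁ j)) (vs (fsuc j))))

record LabIso {A B L : Set} (ArcA : A → A → Set) (ArcB : B → B → Set)
              (la : L → A) (lb : L → B) : Set where
  field
    bij   : A ↔ B
  open Inverse bij public using (to; from)
  field
    arcs  : ∀ u v → ArcA u v ⇔ ArcB (to u) (to v)
    fixes : ∀ l → to (la l) ≡ lb l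

PedIso : ∀ {n} → Pedigree n → Pedigree n → Set
PedIso T U = LabIso (Arc (raw T)) (Arc (raw U)) (extant (raw T)) (extant (raw U))

-- Sub-pedigree 𝒯(Y): vertices having a descendant in Y, with induced arcs.
InSub : ∀ {n} (T : Pedigree n) (Y : Subset n) → V (raw T) → Set
InSub T Y v = ∃[ i ] (i ∈ Y × Desc (raw T) (extant (raw T) i) v)

SubV : ∀ {n} (T : Pedigree n) (Y : Subset n) → Set
SubV T Y = Refinement (V (raw T)) (InSub T Y)

SubArc : ∀ {n} (T : Pedigree n) (Y : Subset n) → SubV T Y → SubV T Y → Set
SubArc T Y u v = Arc (raw T) (value u) (value v)

SubLab : ∀ {n} (T : Pedigree n) (Y : Subset n) →
         Refinement (Fin n) (_∈ Y) → SubV T Y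
SubLab T Y (i , [ p ]) = extant (raw T) i , [ (i , p , here) ]

SubIso : ∀ {n} (T U : Pedigree n) (Y : Subset n) → Set
SubIso T U Y = LabIso (SubArc T Y) (SubArc U Y) (SubLab T Y) (SubLab U Y)

Hypomorphic : ∀ {n} → Pedigree n → Pedigree n → Set
Hypomorphic {n} T U = ∀ (Y : Subset n) → ∣ Y ∣ ≡ n Data.Nat.∸ 1 → SubIso T U Y

module Submission where

open import Defs
open import Data.Nat using (ℕ; zero; suc; _+_; _<_; _∸_; s≤s; z≤n)
open import Data.Fin using (Fin; _≟_; inject₁; fromℕ) renaming (zero to fzero; suc to fsuc)
open import Data.Fin.Properties using (¬∀⟶∃¬; pigeonhole; <⇒≢; 0≢1+n; suc-injective)
open import Data.Fin.Subset using (Subset; _∈_; ∣_∣; ∁; ⁅_⁆)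
open import Data.Fin.Subset.Properties using (x∉p⇒x∈∁p; x∈∁p⇒x∉p; x∈⁅x⁆; x∈⁅y⁆⇒x≡y; ∣∁p∣≡n∸∣p∣; ∣⁅x⁆∣≡1)
open import Data.Vec using (Vec; []; _∷_; lookup)
open import Data.Vec.Membership.Propositional using (_∉_) renaming (_∈_ to _∈ᵥ_)
open import Data.Vec.Relation.Unary.Any using (any?; index; here; there)
open import Data.Vec.Relation.Unary.Any.Properties using (lookup-index)
open import Data.Product using (∃; _×_; _,_; proj₁)
open import Data.Sum using (_⊎_; inj₁; inj₂; swap)
open import Data.Empty using (⊥-elim; ⊥-elim-irr)
open import Data.Irrelevant using ([_])
open import Data.Refinement using (value; _,_; value-injective)
open import Function using (_∘_; flip)
open import Function.Definitions using (Injective)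
open import Function.Bundles using (_⇔_; Inverse; Injection; Equivalence; mk⇔; mk↔ₛ′)
open import Function.Properties.Inverse using (↔⇒↣)
open import Relation.Binary.PropositionalEquality using (_≡_; _≢_; refl; sym; trans; cong; subst)
open import Relation.Nullary using (¬_; yes; no)

-- Let xᵢ be the child of an edge of the cycle in G₁, with parents p and q. Each of p, q
-- is pinned: it has another child x_j (the neighbouring edge of the cycle) each of whose
-- parents is a parent of xᵢ or is told apart from it by a further child x_j′ (the next
-- edge along). Comparing the isomorphism φ of the sub-pedigrees with xᵢ deleted and the
-- one with a fourth extant vertex deleted (this is where n > 3 enters) shows that the
-- parents of xᵢ in 𝒰 are φ p and φ q, so φ extends to the whole pedigree by xᵢ ↦ xᵢ.

allBut : ∀ {n} → Fin n → Subset n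
allBut i = ∁ ⁅ i ⁆

∣allBut∣ : ∀ {n} (i : Fin n) → ∣ allBut i ∣ ≡ n ∸ 1
∣allBut∣ {n} i = trans (∣∁p∣≡n∸∣p∣ ⁅ i ⁆) (cong (n ∸_) (∣⁅x⁆∣≡1 i))

∈allBut⁺ : ∀ {n} {i j : Fin n} → j ≢ i → j ∈ allBut i
∈allBut⁺ j≢i = x∉p⇒x∈∁p (j≢i ∘ x∈⁅y⁆⇒x≡y _)

∈allBut⁻ : ∀ {n} {i j : Fin n} → j ∈ allBut i → j ≢ i
∈allBut⁻ j∈ refl = x∈∁p⇒x∉p j∈ (x∈⁅x⁆ _)

∃-∉ : ∀ {k n} → k < n → (xs : Vec (Fin n) k) → ∃ λ m → m ∉ xs
∃-∉ {n = n} k<n xs = ¬∀⟶∃¬ n (_∈ᵥ xs) (λ m → any? (m ≟_) xs) not-all-members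
  where
  -- every element would be found at some index of xs, giving an injection Fin n → Fin k
  not-all-members : ¬ (∀ m → m ∈ᵥ xs)
  not-all-members member with i , j , i<j , same-index ← pigeonhole k<n (index ∘ member) =
    <⇒≢ i<j (trans (lookup-index (member i))
                   (trans (cong (lookup xs) same-index) (sym (lookup-index (member j)))))

Parent : ∀ {n} (P : Pedigree n) → Fin n → V (raw P) → Set
Parent P t w = Arc (raw P) (extant (raw P) t) w

module _ {n} (P : Pedigree n) where
  private
    x : Fin n → V (raw P)
    x = extant (raw P)

  Desc-extant⇒≡ : ∀ {w} i → Desc (raw P) w (x i) → w ≡ x i
  Desc-extant⇒≡ i here = refl
  Desc-extant⇒≡ i (there a d) with refl ← Desc-extant⇒≡ i d =
    ⊥-elim (IsPedigree.extant-in0 (ok P) _ i a)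

  extant∉allBut : ∀ i → ¬ InSub P (allBut i) (x i)
  extant∉allBut i (t , t∈ , d) = ∈allBut⁻ t∈ (IsPedigree.extant-inj (ok P) (Desc-extant⇒≡ i d))

  parent-is-one-of : ∀ {u c d w} → Arc (raw P) u c → Arc (raw P) u d → c ≢ d →
                     Arc (raw P) u w → w ≡ c ⊎ w ≡ d
  parent-is-one-of (_ , _ , e , c∈) (_ , _ , e′ , d∈) c≢d (_ , _ , e″ , w∈)
    with refl ← trans (sym e) e′ | refl ← trans (sym e) e″ with c∈ | d∈ | w∈
  ... | inj₁ refl | inj₁ refl | _       = ⊥-elim (c≢d refl)
  ... | inj₂ refl | inj₂ refl | _       = ⊥-elim (c≢d refl)
  ... | inj₁ refl | inj₂ refl | w∈′     = w∈′
  ... | inj₂ refl | inj₁ refl | w∈′     = swap w∈′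

  ParentsShared : Fin n → Set
  ParentsShared i = ∀ w → Parent P i w → ∃ λ j → j ≢ i × Parent P j w

  Covers : Fin n → Set
  Covers i = ∀ v → v ≢ x i → InSub P (allBut i) v

  allBut-covers : ∀ i → ParentsShared i → Covers i
  allBut-covers i shared v v≢xᵢ with IsPedigree.ancestral (ok P) v
  ... | t , d with t ≟ i
  ... | no t≢i = t , ∈allBut⁺ t≢i , d
  allBut-covers i shared v v≢xᵢ | t , here      | yes refl = ⊥-elim (v≢xᵢ refl)
  allBut-covers i shared v v≢xᵢ | t , there a d | yes refl with j , j≢i , b ← shared _ a =
    j , ∈allBut⁺ j≢i , there b d

  Joins-parentˡ : ∀ {i u w} → Joins P i u w → Parent P i u
  Joins-parentˡ {u = u} {w} (inj₁ e) = u , w , e , inj₁ refl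
  Joins-parentˡ {u = u} {w} (inj₂ e) = w , u , e , inj₂ refl

  Joins-parentʳ : ∀ {i u w} → Joins P i u w → Parent P i w
  Joins-parentʳ = Joins-parentˡ ∘ swap

  Joins-distinct : ∀ {i u w} → Joins P i u w → u ≢ w
  Joins-distinct (inj₁ e) = proj₁ (IsPedigree.parents-ok (ok P) _ _ _ e)
  Joins-distinct (inj₂ e) = proj₁ (IsPedigree.parents-ok (ok P) _ _ _ e) ∘ sym

  Joins-parent⇒ : ∀ {i u w a} → Joins P i u w → Parent P i a → a ≡ u ⊎ a ≡ w
  Joins-parent⇒ J = parent-is-one-of (Joins-parentˡ J) (Joins-parentʳ J) (Joins-distinct J)

  Joins-¬parent : ∀ {i u w r} → Joins P i u w → r ≢ u → r ≢ w → ¬ Parent P i r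
  Joins-¬parent J r≢u r≢w a with Joins-parent⇒ J a
  ... | inj₁ r≡u = r≢u r≡u
  ... | inj₂ r≡w = r≢w r≡w

module _ {n} (T U : Pedigree n) {Y : Subset n} (φ : SubIso T U Y) where
  open LabIso φ

  parent-iff : ∀ {t} → t ∈ Y → (a : SubV T Y) → Parent T t (value a) ⇔ Parent U t (value (to a))
  parent-iff {t} t∈ a =
    subst (λ b → Parent T t (value a) ⇔ Arc (raw U) (value b) (value (to a)))
          (fixes (t , [ t∈ ])) (arcs (SubLab T Y (t , [ t∈ ])) a)

  from-parent : ∀ {t} → t ∈ Y → (b : SubV U Y) → Parent U t (value b) → Parent T t (value (from b))
  from-parent t∈ b =
    Equivalence.from (parent-iff t∈ (from b)) ∘
    subst (Parent U _ ∘ value) (sym (Inverse.strictlyInverseˡ bij b))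

  to-value-injective : ∀ a b → value (to a) ≡ value (to b) → value a ≡ value b
  to-value-injective a b e = cong value (Injection.injective (↔⇒↣ bij) (value-injective e))

Pinned : ∀ {n} (P : Pedigree n) → Fin n → V (raw P) → Set
Pinned {n} P i r = ∃ λ (j : Fin n) → ∃ λ (j′ : Fin n) → j ≢ i × j′ ≢ i × Parent P j r ×
  (∀ a → Parent P j a → Parent P i a ⊎ (Parent P j′ a × ¬ Parent P j′ r))

module _ {n} (T U : Pedigree n) (3<n : 3 < n) (hyp : Hypomorphic T U) {i : Fin n} where
  private
    φ : SubIso T U (allBut i)
    φ = hyp (allBut i) (∣allBut∣ i)

  -- With ψ the isomorphism avoiding a fourth vertex x_m, ψ⁻¹(φ r) is a parent of x_j; were it
  -- a parent of x_j′, then so would be φ r in 𝒰, and r in 𝒯.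
  pinned-parent-preserved : (r : SubV T (allBut i)) → Pinned T i (value r) →
                            Parent U i (value (LabIso.to φ r))
  pinned-parent-preserved r (j , j′ , j≢i , j′≢i , r-parent , other)
    with m , m∉ ← ∃-∉ 3<n (i ∷ j ∷ j′ ∷ []) = conclude (other (value a) a-parent)
    where
    ψ : SubIso T U (allBut m)
    ψ = hyp (allBut m) (∣allBut∣ m)

    kept : ∀ {t} → t ∈ᵥ (i ∷ j ∷ j′ ∷ []) → t ∈ allBut m
    kept t∈ = ∈allBut⁺ λ { refl → m∉ t∈ }

    w : V (raw U)
    w = value (LabIso.to φ r)

    w-parent : Parent U j w
    w-parent = Equivalence.to (parent-iff T U φ (∈allBut⁺ j≢i) r) r-parent

    b : SubV U (allBut m)
    b = w , [ j , kept (there (here refl)) , there w-parent here ]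

    a : SubV T (allBut m)
    a = LabIso.from ψ b

    a-parent : Parent T j (value a)
    a-parent = from-parent T U ψ (kept (there (here refl))) b w-parent

    ψa≡w : value (LabIso.to ψ a) ≡ w
    ψa≡w = cong value (Inverse.strictlyInverseˡ (LabIso.bij ψ) b)

    ψ-parent : ∀ {t} → t ∈ᵥ (i ∷ j ∷ j′ ∷ []) → Parent T t (value a) → Parent U t w
    ψ-parent t∈ = subst (Parent U _) ψa≡w ∘ Equivalence.to (parent-iff T U ψ (kept t∈) a)

    conclude : Parent T i (value a) ⊎ (Parent T j′ (value a) × ¬ Parent T j′ (value r)) →
               Parent U i w
    conclude (inj₁ i-parent) = ψ-parent (here refl) i-parent
    conclude (inj₂ (j′-parent , r-not-j′-parent)) = ⊥-elim (r-not-j′-parent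
      (subst (Parent T j′ ∘ value) (Inverse.strictlyInverseʳ (LabIso.bij φ) r)
        (from-parent T U φ (∈allBut⁺ j′≢i) (LabIso.to φ r)
          (ψ-parent (there (there (here refl))) j′-parent))))

module _ {n} (A B : Pedigree n) (i : Fin n) (coverA : Covers A i) where
  extendAt : (SubV A (allBut i) → SubV B (allBut i)) → V (raw A) → V (raw B)
  extendAt f u with u ≟ extant (raw A) i
  ... | yes _   = extant (raw B) i
  ... | no u≢xᵢ = value (f (u , [ coverA u u≢xᵢ ]))

  extendAt-extant : ∀ f → extendAt f (extant (raw A) i) ≡ extant (raw B) i
  extendAt-extant f with extant (raw A) i ≟ extant (raw A) i
  ... | yes _ = refl
  ... | no xᵢ≢xᵢ = ⊥-elim (xᵢ≢xᵢ refl)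

  extendAt-value : ∀ f (a : SubV A (allBut i)) → extendAt f (value a) ≡ value (f a)
  extendAt-value f (u , [ u∈ ]) with u ≟ extant (raw A) i
  ... | yes refl = ⊥-elim-irr (extant∉allBut A i u∈)
  ... | no _     = refl

extendAt-inverse : ∀ {n} (A B : Pedigree n) (i : Fin n) (coverA : Covers A i) (coverB : Covers B i)
  (f : SubV A (allBut i) → SubV B (allBut i)) (g : SubV B (allBut i) → SubV A (allBut i)) →
  (∀ b → f (g b) ≡ b) → ∀ y → extendAt A B i coverA f (extendAt B A i coverB g y) ≡ y
extendAt-inverse A B i coverA coverB f g f∘g≡id y with y ≟ extant (raw B) i
... | yes refl = extendAt-extant A B i coverA f
... | no y≢xᵢ  = trans (extendAt-value A B i coverA f (g b)) (cong value (f∘g≡id b))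
  where
  b : SubV B (allBut i)
  b = y , [ coverB y y≢xᵢ ]

extend-iso : ∀ {n} (T U : Pedigree n) (i : Fin n) (φ : SubIso T U (allBut i)) →
  Covers T i → Covers U i →
  (∀ a → Parent T i (value a) ⇔ Parent U i (value (LabIso.to φ a))) → PedIso T U
extend-iso T U i φ coverT coverU parents-match = record
  { bij   = mk↔ₛ′ to′ from′ (extendAt-inverse T U i coverT coverU to from strictlyInverseˡ)
                              (extendAt-inverse U T i coverU coverT from to strictlyInverseʳ)
  ; arcs  = arcs′
  ; fixes = fixes′
  }
  where
  open LabIso φ using (to; from; arcs; fixes; bij)
  open Inverse bij using (strictlyInverseˡ; strictlyInverseʳ)

  to′ : V (raw T) → V (raw U)
  to′ = extendAt T U i coverT to

  from′ : V (raw U) → V (raw T)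
  from′ = extendAt U T i coverU from

  arcs′ : ∀ u v → Arc (raw T) u v ⇔ Arc (raw U) (to′ u) (to′ v)
  arcs′ u v with v ≟ extant (raw T) i
  ... | yes refl = mk⇔ (⊥-elim ∘ IsPedigree.extant-in0 (ok T) u i)
                       (⊥-elim ∘ IsPedigree.extant-in0 (ok U) (to′ u) i)
  ... | no v≢xᵢ with u ≟ extant (raw T) i
  ...   | yes refl = parents-match (v , [ coverT v v≢xᵢ ])
  ...   | no u≢xᵢ  = arcs (u , [ coverT u u≢xᵢ ]) (v , [ coverT v v≢xᵢ ])

  fixes′ : ∀ t → to′ (extant (raw T) t) ≡ extant (raw U) t
  fixes′ t with t ≟ i
  ... | yes refl = extendAt-extant T U i coverT to
  ... | no t≢i   = trans (extendAt-value T U i coverT to xₜ) (cong value (fixes (t , [ ∈allBut⁺ t≢i ])))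
    where
    xₜ : SubV T (allBut i)
    xₜ = SubLab T (allBut i) (t , [ ∈allBut⁺ t≢i ])

pinned-via : ∀ {n} (P : Pedigree n) {i j p q r} → Joins P i p q → j ≢ i → Joins P j r p →
  r ≡ q ⊎ (∃ λ j′ → j′ ≢ i × Parent P j′ r × ¬ Parent P j′ p) → Pinned P i p
pinned-via P {i} {j} Jᵢ j≢i Jⱼ (inj₁ r≡q) = j , j , j≢i , j≢i , Joins-parentʳ P Jⱼ , both-shared
  where
  both-shared : ∀ a → Parent P j a → _
  both-shared a a-parent with Joins-parent⇒ P Jⱼ a-parent
  ... | inj₁ refl = inj₁ (subst (Parent P i) (sym r≡q) (Joins-parentʳ P Jᵢ))
  ... | inj₂ refl = inj₁ (Joins-parentˡ P Jᵢ)
pinned-via P {j = j} Jᵢ j≢i Jⱼ (inj₂ (j′ , j′≢i , r-parent , p-not-parent)) =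
  j , j′ , j≢i , j′≢i , Joins-parentʳ P Jⱼ , told-apart
  where
  told-apart : ∀ a → Parent P j a → _
  told-apart a a-parent with Joins-parent⇒ P Jⱼ a-parent
  ... | inj₁ refl = inj₂ (r-parent , p-not-parent)
  ... | inj₂ refl = inj₁ (Joins-parentˡ P Jᵢ)

record Cycle {n} (T : Pedigree n) (k : ℕ) : Set where
  field
    edge             : Fin k → Fin n
    vertex           : Fin (suc k) → V (raw T)
    edge-injective   : Injective _≡_ _≡_ edge
    vertex-injective : Injective _≡_ _≡_ (vertex ∘ inject₁)
    closed           : vertex (fromℕ k) ≡ vertex fzero
    joins            : ∀ j → Joins T (edge j) (vertex (inject₁ j)) (vertex (fsuc j))

module _ {n} {T : Pedigree n} where
  open Cycle

  edge≢edge₀ : ∀ {k} (C : Cycle T (suc k)) j → edge C (fsuc j) ≢ edge C fzero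
  edge≢edge₀ C j = 0≢1+n ∘ sym ∘ edge-injective C

  vertex₀≢ : ∀ {k} (C : Cycle T (suc k)) j → vertex C fzero ≢ vertex C (inject₁ (fsuc j))
  vertex₀≢ C j = 0≢1+n ∘ vertex-injective C

  vertex₁≢ : ∀ {k} (C : Cycle T (suc (suc k))) j →
             vertex C (fsuc fzero) ≢ vertex C (inject₁ (fsuc (fsuc j)))
  vertex₁≢ C j = 0≢1+n ∘ suc-injective ∘ vertex-injective C

  first-vertex-pinned : ∀ k → (C : Cycle T (2 + k)) → Pinned T (edge C fzero) (vertex C fzero)
  first-vertex-pinned k C =
    pinned-via T (joins C fzero) (edge≢edge₀ C (fromℕ k))
      (subst (Joins T _ _) (closed C) (joins C (fromℕ (suc k)))) (alternative k C)
    where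
    -- the closing edge joins v_{k+1} and v₀; for k > 0 the edge before it separates them
    alternative : ∀ k (C : Cycle T (2 + k)) →
      vertex C (inject₁ (fromℕ (suc k))) ≡ vertex C (fsuc fzero) ⊎
      ∃ λ j′ → j′ ≢ edge C fzero × Parent T j′ (vertex C (inject₁ (fromℕ (suc k)))) ×
               ¬ Parent T j′ (vertex C fzero)
    alternative zero    C = inj₁ refl
    alternative (suc k) C = inj₂ (edge C (fsuc s) , edge≢edge₀ C s , Joins-parentʳ T (joins C (fsuc s)) ,
      Joins-¬parent T (joins C (fsuc s)) (vertex₀≢ C s) (vertex₀≢ C (fromℕ (suc k))))
      where
      s = inject₁ (fromℕ k)

  vertex₁≢vertex₃ : ∀ k (C : Cycle T (3 + k)) → vertex C (fsuc fzero) ≢ vertex C (fsuc (fsuc (fsuc fzero)))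
  vertex₁≢vertex₃ zero    C = vertex₀≢ C fzero ∘ sym ∘ flip trans (closed C)
  vertex₁≢vertex₃ (suc k) C = vertex₁≢ C (fsuc fzero)

  second-vertex-pinned : ∀ k → (C : Cycle T (2 + k)) → Pinned T (edge C fzero) (vertex C (fsuc fzero))
  second-vertex-pinned k C =
    pinned-via T (swap (joins C fzero)) (edge≢edge₀ C fzero) (swap (joins C (fsuc fzero)))
      (alternative k C)
    where
    -- the edge after v₁ v₂ leads back to v₀ when k = 0, and otherwise separates v₂ from v₁
    alternative : ∀ k (C : Cycle T (2 + k)) →
      vertex C (fsuc (fsuc fzero)) ≡ vertex C fzero ⊎
      ∃ λ j′ → j′ ≢ edge C fzero × Parent T j′ (vertex C (fsuc (fsuc fzero))) ×
               ¬ Parent T j′ (vertex C (fsuc fzero))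
    alternative zero    C = inj₁ (closed C)
    alternative (suc k) C =
      inj₂ (edge C (fsuc (fsuc fzero)) , edge≢edge₀ C (fsuc fzero) , Joins-parentˡ T third ,
            Joins-¬parent T third (vertex₁≢ C fzero) (vertex₁≢vertex₃ k C))
      where
      third = joins C (fsuc (fsuc fzero))

determined-by-pinned-edge : ∀ {n} (T U : Pedigree n) {i p q} → 3 < n → Hypomorphic T U →
  Joins T i p q → Pinned T i p → Pinned T i q → PedIso T U
determined-by-pinned-edge T U {i} 3<n hyp Jᵢ p-pinned q-pinned =
  extend-iso T U i φ (allBut-covers T i shared-T) (allBut-covers U i shared-U) parents-match
  where
  φ : SubIso T U (allBut i)
  φ = hyp (allBut i) (∣allBut∣ i)
  open LabIso φ using (to)

  shared-elsewhere : ∀ {r} → Pinned T i r → ∃ λ j → j ≢ i × Parent T j r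
  shared-elsewhere (j , _ , j≢i , _ , r-parent , _) = j , j≢i , r-parent

  kept : ∀ {r} → Pinned T i r → SubV T (allBut i)
  kept {r} (j , _ , j≢i , _ , r-parent , _) = r , [ j , ∈allBut⁺ j≢i , there r-parent here ]

  image-parent : ∀ {r} (pin : Pinned T i r) → Parent U i (value (to (kept pin)))
  image-parent pin = pinned-parent-preserved T U 3<n hyp (kept pin) pin

  image-shared : ∀ {r} (pin : Pinned T i r) → ∃ λ j → j ≢ i × Parent U j (value (to (kept pin)))
  image-shared pin@(j , _ , j≢i , _ , r-parent , _) =
    j , j≢i , Equivalence.to (parent-iff T U φ (∈allBut⁺ j≢i) (kept pin)) r-parent

  shared-T : ParentsShared T i
  shared-T w w-parent with Joins-parent⇒ T Jᵢ w-parent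
  ... | inj₁ refl = shared-elsewhere p-pinned
  ... | inj₂ refl = shared-elsewhere q-pinned

  parent-in-U⇒ : ∀ {w} → Parent U i w → w ≡ value (to (kept p-pinned)) ⊎ w ≡ value (to (kept q-pinned))
  parent-in-U⇒ = parent-is-one-of U (image-parent p-pinned) (image-parent q-pinned)
    (Joins-distinct T Jᵢ ∘ to-value-injective T U φ (kept p-pinned) (kept q-pinned))

  shared-U : ParentsShared U i
  shared-U w w-parent with parent-in-U⇒ w-parent
  ... | inj₁ refl = image-shared p-pinned
  ... | inj₂ refl = image-shared q-pinned

  parents-match : ∀ a → Parent T i (value a) ⇔ Parent U i (value (to a))
  parents-match a = mk⇔ forward backward
    where
    forward : Parent T i (value a) → Parent U i (value (to a))
    forward a-parent with Joins-parent⇒ T Jᵢ a-parent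
    ... | inj₁ a≡p = subst (Parent U i ∘ value ∘ to) (sym (value-injective a≡p)) (image-parent p-pinned)
    ... | inj₂ a≡q = subst (Parent U i ∘ value ∘ to) (sym (value-injective a≡q)) (image-parent q-pinned)

    backward : Parent U i (value (to a)) → Parent T i (value a)
    backward φa-parent with parent-in-U⇒ φa-parent
    ... | inj₁ e = subst (Parent T i) (sym (to-value-injective T U φ a (kept p-pinned) e)) (Joins-parentˡ T Jᵢ)
    ... | inj₂ e = subst (Parent T i) (sym (to-value-injective T U φ a (kept q-pinned) e)) (Joins-parentʳ T Jᵢ)

lemma2 : ∀ {n : ℕ} (T : Pedigree n) → 3 < n → DiscreteGeneration T →
         G₁HasCycle T → (U : Pedigree n) → Hypomorphic T U → PedIso T U
lemma2 T 3<n _ (suc (suc k) , s≤s (s≤s z≤n) , es , vs , es-inj , vs-inj , closed , joins) U hyp =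
  determined-by-pinned-edge T U 3<n hyp (Cycle.joins C fzero) (first-vertex-pinned k C) (second-vertex-pinned k C)
  where
  C : Cycle T (2 + k)
  C = record { edge = es ; vertex = vs ; edge-injective = es-inj ; vertex-injective = vs-inj
             ; closed = closed ; joins = joins }
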